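{- Let $H$ be a self-dual good conduit with parameters $(\tau,\Delta,\gamma,c)$ between parts $A$ and $B$ with $|A|=|B|=n$, where $\tau\ge 3$, and let $\sigma:A\to B$ be a self-duality bijection. Let $\psi(H)$ (an $H$-cycle of length $\tau$) be the graph with vertex set $\mathbb{Z}_\tau\times A$ in which $(j,a)$ and $(j+1,a')$ (indices mod $\tau$) are adjacent whenever $a\sigma(a')$ is an edge of $H$, and there are no other edges. Then $\psi(H)$ is regular of degree $2\Delta$, has girth $\min\{\tau,4\}$, has $\tau n$ ($\ge \tau c\Delta^\tau$) vertices, and between every two vertices of $\psi(H)$ there is a path of length at most $\tau$.
   Context: A balanced bipartite graph $H$ with parts $A$ and $B$, $|A|=|B|$, is a good conduit (between $A$ and $B$) with parameters $(\tau,\Delta,\gamma,c)$ (where $c>0$) if $H$ has girth $\gamma$, $H$ is regular of degree $\Delta$, for every $a\in A$ and $b\in B$ there is a path of length at most $\tau$ between $a$ and $b$ in $H$, and $|A|\ge c\Delta^\tau$. Such a good conduit is self-dual if there is a bijection $\sigma:A\to B$ such that the map sending each $a\in A$ to $\sigma(a)$ and each $b\in B$ to $\sigma^{ -1}(b)$ is an automorphism of $H$ (so $\psi(H)$ consists of $\tau$ copies of $H$ joined end-to-end in a cycle with vertices identified via $\sigma$; the adjacency rule above is symmetric by self-duality).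
   Formalization: The constant c of the good conduit takes only positive rational values. -}

module Defs where

open import Data.Nat as ℕ using (ℕ; zero; suc; _≤_; _<_; _⊓_; _^_)
open import Data.Nat.DivMod using (_%_; m%n<n)
open import Data.Fin as Fin using (Fin; toℕ; fromℕ; fromℕ<; inject₁)
open import Data.Fin.Properties using (_≟_)
open import Data.Bool using (Bool; true; false; T; _∧_; _∨_)
open import Data.Sum using (_⊎_; inj₁; inj₂)
open import Data.Product using (Σ; Σ-syntax; ∃; ∃-syntax; _×_; _,_)
open import Data.Integer using (+_)
open import Data.Rational using (ℚ; _/_)
open import Function.Bundles using (_↔_; Inverse)
open import Function.Definitions using (Injective; Bijective)
open import Relation.Binary.PropositionalEquality using (_≡_)
open import Relation.Nullary using (¬_)
open import Relation.Nullary.Decidable using (⌊_⌋)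

record Graph : Set₁ where
  field
    V   : Set
    adj : V → V → Bool

module _ (G : Graph) where
  open Graph G

  Adj : V → V → Set
  Adj u v = T (adj u v)

  Nbhd : V → Set
  Nbhd v = Σ V (λ w → Adj v w)

  IsRegular : ℕ → Set
  IsRegular d = ∀ v → Nbhd v ↔ Fin d

  record PathOfLength (k : ℕ) (u v : V) : Set where
    field
      vert     : Fin (suc k) → V
      distinct : Injective _≡_ _≡_ vert
      start    : vert Fin.zero ≡ u
      end      : vert (fromℕ k) ≡ v
      step     : ∀ (i : Fin k) → Adj (vert (inject₁ i)) (vert (Fin.suc i))

  PathAtMost : ℕ → V → V → Set
  PathAtMost k u v = ∃[ l ] (l ≤ k × PathOfLength l u v)

  record CycleOfLength (k : ℕ) : Set where
    field
      len≥3    : 3 ≤ k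
      vert     : Fin k → V
      distinct : Injective _≡_ _≡_ vert
      step     : ∀ (i : Fin k) (j : Fin k) → toℕ j ≡ suc (toℕ i) → Adj (vert i) (vert j)
      close    : ∀ (i : Fin k) → suc (toℕ i) ≡ k → (z : Fin k) → toℕ z ≡ 0 → Adj (vert i) (vert z)

  HasGirth : ℕ → Set
  HasGirth g = CycleOfLength g × (∀ k → k < g → ¬ CycleOfLength k)

  IsAutomorphism : (V → V) → Set
  IsAutomorphism f = Bijective _≡_ _≡_ f × (∀ u v → adj u v ≡ adj (f u) (f v))

bipartite : (n : ℕ) → (Fin n → Fin n → Bool) → Graph
bipartite n e = record { V = Fin n ⊎ Fin n ; adj = ad }
  where
  ad : Fin n ⊎ Fin n → Fin n ⊎ Fin n → Bool
  ad (inj₁ a) (inj₂ b) = e a b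
  ad (inj₂ b) (inj₁ a) = e a b
  ad (inj₁ _) (inj₁ _) = false
  ad (inj₂ _) (inj₂ _) = false

ℕ→ℚ : ℕ → ℚ
ℕ→ℚ m = (+ m) / 1

record GoodConduit (n : ℕ) (e : Fin n → Fin n → Bool) (τ Δ γ : ℕ) (c : ℚ) : Set where
  field
    c-pos   : Data.Rational._<_ (ℕ→ℚ 0) c
    girth   : HasGirth (bipartite n e) γ
    regular : IsRegular (bipartite n e) Δ
    conn    : ∀ (a b : Fin n) → PathAtMost (bipartite n e) τ (inj₁ a) (inj₂ b)
    size    : Data.Rational._≤_ (Data.Rational._*_ c (ℕ→ℚ (Δ ^ τ))) (ℕ→ℚ n)

dualSwap : ∀ {n} → Fin n ↔ Fin n → Fin n ⊎ Fin n → Fin n ⊎ Fin n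
dualSwap σ (inj₁ a) = inj₂ (Inverse.to σ a)
dualSwap σ (inj₂ b) = inj₁ (Inverse.from σ b)

IsSelfDuality : ∀ {n} (e : Fin n → Fin n → Bool) → Fin n ↔ Fin n → Set
IsSelfDuality {n} e σ = IsAutomorphism (bipartite n e) (dualSwap σ)

sucMod : (τ : ℕ) → Fin τ → Fin τ
sucMod (suc m) i = fromℕ< (m%n<n (suc (toℕ i)) (suc m))

ψ : (τ n : ℕ) → (Fin n → Fin n → Bool) → Fin n ↔ Fin n → Graph
ψ τ n e σ = record { V = Fin τ × Fin n ; adj = ad }
  where
  σ⁺ = Inverse.to σ
  ad : Fin τ × Fin n → Fin τ × Fin n → Bool
  ad (j , a) (j' , a') =
    (⌊ j' ≟ sucMod τ j ⌋ ∧ e a (σ⁺ a')) ∨ (⌊ j ≟ sucMod τ j' ⌋ ∧ e a' (σ⁺ a))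

-- Let R be the relation on A with a R b iff a σ(b) ∈ E(H); self-duality makes it symmetric, and
-- ψ(H) is the product of the τ-cycle with R: a walk in ψ(H) is a walk around the cycle zipped with an
-- R-walk of the same length, so every neighbourhood is a copy of N_H(a) plus a copy of N_H(σ a).
-- H is bipartite, so its A–B paths give R-walks of odd length ≤ τ; bouncing on an edge lengthens a
-- walk by 2 and a first step to a neighbour changes its parity.  Hence R-walks of length τ, and of
-- length τ - 1 when that is odd, join any two points; the cycle has walks of one of these lengths
-- between any two layers, and erasing loops from the zipped walk gives the path.  A closed R-walk of
-- length τ wound once around the cycle is a τ-cycle; for τ ≥ 4 a vertex x of a cycle of H with
-- R-neighbours y ≠ w gives the 4-cycle (0,x)(1,y)(2,x)(1,w), and a triangle is impossible because
-- three steps of ±1 cannot add up to 0 mod τ.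

module Submission where

open import Defs
open import Data.Nat using (ℕ; zero; suc; _+_; _*_; _∸_; _≤_; _<_; _⊓_; z≤n; s≤s)
open import Data.Nat.Properties
open import Data.Nat.DivMod
open import Data.Nat.GeneralisedArithmetic using (iterate)
import Data.Nat.Coprimality as Coprime
open import Data.Fin using (Fin; toℕ; fromℕ; fromℕ<; inject₁) renaming (zero to fzero; suc to fsuc)
import Data.Fin.Properties as Fin
open import Data.Fin.Properties
  using (any?; toℕ-injective; toℕ-fromℕ<; toℕ<n; toℕ-inject₁; toℕ-fromℕ; +↔⊎; *↔×)
open import Data.Bool using (Bool; T; _∧_)
open import Data.Bool.Properties using (T-∧; T-∨; T-irrelevant)
open import Data.Integer using (+_)
import Data.Integer.Properties as ℤ
open import Data.Rational using (ℚ; mkℚ; NonNegative)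
import Data.Rational as ℚ
open import Data.Rational.Properties using (normalize-coprime; /-cong; *-monoˡ-≤-nonNeg)
open import Data.Product using (Σ; ∃-syntax; _×_; _,_; proj₁; proj₂)
open import Data.Product.Properties using (≡-dec)
open import Data.Sum using (_⊎_; inj₁; inj₂)
import Data.Sum as Sum
open import Data.Sum.Function.Propositional using (_⊎-↔_)
open import Data.Empty using (⊥; ⊥-elim)
open import Function.Bundles using (_↔_; Inverse; Equivalence; mk↔ₛ′)
open import Function.Definitions using (Injective)
open import Function.Properties.Inverse using (↔-refl; ↔-sym; ↔-trans)
open import Relation.Nullary using (¬_; yes; no)
open import Relation.Nullary.Decidable using (⌊_⌋; fromWitness; toWitness)
open import Relation.Binary.Definitions using (DecidableEquality)
open import Relation.Binary.PropositionalEquality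

infix 4 _≤₂_

_≤₂_ : ℕ → ℕ → Set
k ≤₂ l = ∃[ u ] u * 2 + k ≡ l

Even Odd : ℕ → Set
Even = 0 ≤₂_
Odd  = 1 ≤₂_

≤₂-suc : ∀ {k l} → k ≤₂ l → suc k ≤₂ suc l
≤₂-suc {k} (u , eq) = u , trans (+-suc (u * 2) k) (cong suc eq)

odd⇒even-suc : ∀ {k} → Odd k → Even (suc k)
odd⇒even-suc (u , eq) = suc u , trans (+-identityʳ _) (cong suc (trans (+-comm 1 (u * 2)) eq))

parity : ∀ k → Even k ⊎ Odd k
parity zero = inj₁ (0 , refl)
parity (suc k) with parity k
... | inj₁ even = inj₂ (≤₂-suc even)
... | inj₂ odd  = inj₁ (odd⇒even-suc odd)

even⇒¬odd : ∀ {k} → Even k → ¬ Odd k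
even⇒¬odd (u , refl) (v , eq) = double≢double+1 u v (sym eq)
  where
  double≢double+1 : ∀ u v → u * 2 + 0 ≢ v * 2 + 1
  double≢double+1 zero    zero    ()
  double≢double+1 zero    (suc v) ()
  double≢double+1 (suc u) zero    ()
  double≢double+1 (suc u) (suc v) eq = double≢double+1 u v (suc-injective (suc-injective eq))

≤⇒≤₂ : ∀ {p k l} → p ≤₂ k → p ≤₂ l → k ≤ l → k ≤₂ l
≤⇒≤₂ {p} (u , refl) (v , refl) k≤l = v ∸ u , (begin
    (v ∸ u) * 2 + (u * 2 + p) ≡⟨ sym (+-assoc ((v ∸ u) * 2) (u * 2) p) ⟩
    (v ∸ u) * 2 + u * 2 + p   ≡⟨ cong (λ x → x + u * 2 + p) (*-distribʳ-∸ 2 v u) ⟩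
    (v * 2 ∸ u * 2) + u * 2 + p ≡⟨ cong (_+ p) (m∸n+n≡m (*-monoˡ-≤ 2 u≤v)) ⟩
    v * 2 + p ∎)
  where
  open ≡-Reasoning
  u≤v : u ≤ v
  u≤v = *-cancelʳ-≤ u v 2 (+-cancelʳ-≤ p (u * 2) (v * 2) k≤l)

odd<even : ∀ {k l} → Odd k → Even l → k ≤ l → k < l
odd<even odd even k≤l = ≤∧≢⇒< k≤l λ { refl → even⇒¬odd even odd }

even-+ : ∀ {d e} → Even d → Even e → Even (d + e)
even-+ (u , refl) (v , refl) = u + v , (begin
    (u + v) * 2 + 0       ≡⟨ +-identityʳ _ ⟩
    (u + v) * 2           ≡⟨ *-distribʳ-+ 2 u v ⟩
    u * 2 + v * 2         ≡⟨ sym (cong₂ _+_ (+-identityʳ (u * 2)) (+-identityʳ (v * 2))) ⟩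
    u * 2 + 0 + (v * 2 + 0) ∎)
  where open ≡-Reasoning

odd-summand : ∀ {d e} → Even d → Odd (d + e) → Odd e
odd-summand {e = e} even-d odd-sum with parity e
... | inj₁ even-e = ⊥-elim (even⇒¬odd (even-+ even-d even-e) odd-sum)
... | inj₂ odd-e  = odd-e

module _ {V : Set} (_~_ : V → V → Set) where

  data Walk : ℕ → V → V → Set where
    []  : ∀ {x} → Walk 0 x x
    _∷_ : ∀ {x y z k} → x ~ y → Walk k y z → Walk (suc k) x z

module _ {V : Set} {_~_ : V → V → Set} where

  vertex : ∀ {k x y} → Walk _~_ k x y → Fin (suc k) → V
  vertex {x = x} _ fzero = x
  vertex (_ ∷ w) (fsuc i) = vertex w i

  vertex-last : ∀ {k x y} (w : Walk _~_ k x y) → vertex w (fromℕ k) ≡ y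
  vertex-last []      = refl
  vertex-last (_ ∷ w) = vertex-last w

  vertex-step : ∀ {k x y} (w : Walk _~_ k x y) (i : Fin k) → vertex w (inject₁ i) ~ vertex w (fsuc i)
  vertex-step (p ∷ _) fzero    = p
  vertex-step (_ ∷ w) (fsuc i) = vertex-step w i

  walkThrough : ∀ {k} (f : Fin (suc k) → V) → (∀ i → f (inject₁ i) ~ f (fsuc i)) →
                Walk _~_ k (f fzero) (f (fromℕ k))
  walkThrough {zero}  f step = []
  walkThrough {suc k} f step = step fzero ∷ walkThrough (λ i → f (fsuc i)) (λ i → step (fsuc i))

  record PathWithin (k : ℕ) (x y : V) : Set where
    field
      {len}     : ℕ
      len≤      : len ≤ k
      walk      : Walk _~_ len x y
      injective : Injective _≡_ _≡_ (vertex walk)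

  weaken : ∀ {k k' x y} → k ≤ k' → PathWithin k x y → PathWithin k' x y
  weaken k≤k' P = record { len≤ = ≤-trans len≤ k≤k' ; walk = walk ; injective = injective }
    where open PathWithin P

  suffix : ∀ {k x z} (w : Walk _~_ k x z) → Injective _≡_ _≡_ (vertex w) →
           (i : Fin (suc k)) → PathWithin k (vertex w i) z
  suffix w       inj fzero    = record { len≤ = ≤-refl ; walk = w ; injective = inj }
  suffix (_ ∷ w) inj (fsuc i) = weaken (n≤1+n _) (suffix w (λ eq → Fin.suc-injective (inj eq)) i)

  loopErase : DecidableEquality V → ∀ {k x z} → Walk _~_ k x z → PathWithin k x z
  loopErase _≟_ [] = record { len≤ = z≤n ; walk = [] ; injective = λ { {fzero} {fzero} _ → refl } }
  loopErase _≟_ {x = x} (p ∷ w) with loopErase _≟_ w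
  ... | P with any? (λ i → vertex (PathWithin.walk P) i ≟ x)
  ...   | yes (i , revisit) =
          weaken (≤-trans len≤ (n≤1+n _)) (subst (λ v → PathWithin _ v _) revisit (suffix walk injective i))
    where open PathWithin P
  ...   | no fresh = record { len≤ = s≤s len≤ ; walk = p ∷ walk ; injective = inj }
    where
    open PathWithin P
    inj : Injective _≡_ _≡_ (vertex (p ∷ walk))
    inj {fzero}  {fzero}  _  = refl
    inj {fzero}  {fsuc j} eq = ⊥-elim (fresh (j , sym eq))
    inj {fsuc i} {fzero}  eq = ⊥-elim (fresh (i , eq))
    inj {fsuc i} {fsuc j} eq = cong fsuc (injective eq)

  map : ∀ {W : Set} {_≈_ : W → W → Set} (f : V → W) → (∀ {x y} → x ~ y → f x ≈ f y) →
        ∀ {k x y} → Walk _~_ k x y → Walk _≈_ k (f x) (f y)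
  map f f-hom []      = []
  map f f-hom (p ∷ w) = f-hom p ∷ map f f-hom w

  pad : ∀ {k l x y z} → x ~ y → y ~ x → Walk _~_ k x z → k ≤₂ l → Walk _~_ l x z
  pad there back w (u , refl) = bounce u
    where
    bounce : ∀ u → Walk _~_ (u * 2 + _) _ _
    bounce zero    = w
    bounce (suc u) = there ∷ (back ∷ bounce u)

module _ {A B C : Set} {_~_ : A → A → Set} {_≈_ : B → B → Set} {_≋_ : C → C → Set} where

  zipWith : (f : A → B → C) → (∀ {a a' b b'} → a ~ a' → b ≈ b' → f a b ≋ f a' b') →
            ∀ {k a a' b b'} → Walk _~_ k a a' → Walk _≈_ k b b' → Walk _≋_ k (f a b) (f a' b')
  zipWith f f-hom []      []      = []
  zipWith f f-hom (p ∷ v) (q ∷ w) = f-hom p q ∷ zipWith f f-hom v w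

module _ (G : Graph) where
  open Graph G

  walk⇒pathAtMost : DecidableEquality V → ∀ {k k' u v} → k ≤ k' → Walk (Adj G) k u v → PathAtMost G k' u v
  walk⇒pathAtMost _≟_ k≤k' w = len , ≤-trans len≤ k≤k' , record
    { vert = vertex walk ; distinct = injective ; start = refl
    ; end = vertex-last walk ; step = vertex-step walk }
    where open PathWithin (loopErase _≟_ w)

  pathOfLength⇒walk : ∀ {k u v} → PathOfLength G k u v → Walk (Adj G) k u v
  pathOfLength⇒walk P = subst₂ (Walk (Adj G) _) start end (walkThrough vert step)
    where open PathOfLength P

  cycleThrough : ∀ {k} (f : Fin (suc k) → V) → 2 ≤ k → Injective _≡_ _≡_ f →
                 (∀ i → Adj G (f (inject₁ i)) (f (fsuc i))) → Adj G (f (fromℕ k)) (f fzero) →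
                 CycleOfLength G (suc k)
  cycleThrough {k} f 2≤k f-inj step close = record
    { len≥3 = s≤s 2≤k ; vert = f ; distinct = f-inj ; step = step′ ; close = close′ }
    where
    step′ : ∀ i j → toℕ j ≡ suc (toℕ i) → Adj G (f i) (f j)
    step′ i fzero ()
    step′ i (fsuc j) eq = subst₂ (λ x y → Adj G (f x) (f y)) i≡j₁ refl (step j)
      where
      i≡j₁ : inject₁ j ≡ i
      i≡j₁ = toℕ-injective (trans (toℕ-inject₁ j) (suc-injective eq))
    close′ : ∀ i → suc (toℕ i) ≡ suc k → ∀ z → toℕ z ≡ 0 → Adj G (f i) (f z)
    close′ i eq fzero    _ = subst (λ x → Adj G (f x) (f fzero)) i≡last close
      where
      i≡last : fromℕ k ≡ i
      i≡last = toℕ-injective (trans (toℕ-fromℕ k) (sym (suc-injective eq)))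
    close′ i eq (fsuc z) ()

module Layers (m : ℕ) where

  τ : ℕ
  τ = suc m

  s : Fin τ → Fin τ
  s = sucMod τ

  reduce : ℕ → Fin τ
  reduce p = fromℕ< (m%n<n p τ)

  reduce-≡ : ∀ {p q} → p % τ ≡ q % τ → reduce p ≡ reduce q
  reduce-≡ {p} {q} eq =
    toℕ-injective (trans (toℕ-fromℕ< (m%n<n p τ)) (trans eq (sym (toℕ-fromℕ< (m%n<n q τ)))))

  reduce-toℕ : ∀ j → reduce (toℕ j) ≡ j
  reduce-toℕ j = toℕ-injective (trans (toℕ-fromℕ< (m%n<n (toℕ j) τ)) (m<n⇒m%n≡m (toℕ<n j)))

  reduce-suc : ∀ p → reduce (suc p) ≡ s (reduce p)
  reduce-suc p = reduce-≡ {suc p} {suc (toℕ (reduce p))} (begin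
    suc p % τ                    ≡⟨ cong (λ x → suc x % τ) (m≡m%n+[m/n]*n p τ) ⟩
    suc (p % τ + p / τ * τ) % τ  ≡⟨ [m+kn]%n≡m%n (suc (p % τ)) (p / τ) τ ⟩
    suc (p % τ) % τ              ≡⟨ cong (λ x → suc x % τ) (sym (toℕ-fromℕ< (m%n<n p τ))) ⟩
    suc (toℕ (reduce p)) % τ        ∎)
    where open ≡-Reasoning

  reduce-τ+ : ∀ p → reduce (τ + p) ≡ reduce p
  reduce-τ+ p = reduce-≡ {τ + p} {p} (trans (cong (_% τ) (+-comm τ p)) ([m+n]%n≡m%n p τ))

  -- if k + r wrapped around it would land strictly below r
  mod-window : ∀ {k r} → k < τ → r < τ → (k + r) % τ ≡ r → k ≡ 0
  mod-window {k} {r} k<τ r<τ wrap with k + r <? τ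
  ... | yes small = +-cancelʳ-≡ r k 0 (trans (sym (m<n⇒m%n≡m small)) wrap)
  ... | no large  = ⊥-elim (<-irrefl (+-cancelʳ-≡ r k τ k+r≡τ+r) k<τ)
    where
    τ≤k+r = ≮⇒≥ large
    k+r∸τ<τ : k + r ∸ τ < τ
    k+r∸τ<τ = ≤-<-trans (∸-monoˡ-≤ τ (+-monoˡ-≤ r (<⇒≤ k<τ)))
                        (subst (_< τ) (sym (m+n∸m≡n τ r)) r<τ)
    k+r∸τ≡r : k + r ∸ τ ≡ r
    k+r∸τ≡r = trans (sym (m<n⇒m%n≡m k+r∸τ<τ)) (trans (m≤n⇒[n∸m]%m≡n%m τ≤k+r) wrap)
    k+r≡τ+r : k + r ≡ τ + r
    k+r≡τ+r = trans (sym (m∸n+n≡m τ≤k+r)) (trans (cong (_+ τ) k+r∸τ≡r) (+-comm r τ))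

  reduce-window : ∀ {k} p → k < τ → reduce (k + p) ≡ reduce p → k ≡ 0
  reduce-window {k} p k<τ eq = mod-window k<τ (m%n<n p τ) (begin
    (k + r) % τ               ≡⟨ sym ([m+kn]%n≡m%n (k + r) (p / τ) τ) ⟩
    (k + r + p / τ * τ) % τ   ≡⟨ cong (_% τ) (+-assoc k r (p / τ * τ)) ⟩
    (k + (r + p / τ * τ)) % τ ≡⟨ cong (λ x → (k + x) % τ) (sym (m≡m%n+[m/n]*n p τ)) ⟩
    (k + p) % τ               ≡⟨ sym (toℕ-fromℕ< (m%n<n (k + p) τ)) ⟩
    toℕ (reduce (k + p))         ≡⟨ cong toℕ eq ⟩
    toℕ (reduce p)               ≡⟨ toℕ-fromℕ< (m%n<n p τ) ⟩
    r                         ∎)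
    where
    open ≡-Reasoning
    r = p % τ

  s-reduce : ∀ j → s j ≡ reduce (suc (toℕ j))
  s-reduce j = trans (cong s (sym (reduce-toℕ j))) (sym (reduce-suc (toℕ j)))

  s-inject₁ : ∀ (i : Fin m) → s (inject₁ i) ≡ fsuc i
  s-inject₁ i =
    trans (s-reduce (inject₁ i)) (trans (cong (λ x → reduce (suc x)) (toℕ-inject₁ i)) (reduce-toℕ (fsuc i)))

  s-fromℕ : s (fromℕ m) ≡ fzero
  s-fromℕ = begin
    s (fromℕ m)               ≡⟨ s-reduce (fromℕ m) ⟩
    reduce (suc (toℕ (fromℕ m))) ≡⟨ cong (λ x → reduce (suc x)) (toℕ-fromℕ m) ⟩
    reduce τ                     ≡⟨ cong reduce (sym (+-identityʳ τ)) ⟩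
    reduce (τ + 0)               ≡⟨ reduce-τ+ 0 ⟩
    reduce 0                     ≡⟨ reduce-toℕ fzero ⟩
    fzero                     ∎
    where open ≡-Reasoning

  iterate-reduce : ∀ k p → iterate s (reduce p) k ≡ reduce (k + p)
  iterate-reduce zero    p = refl
  iterate-reduce (suc k) p = begin
    iterate s (s (reduce p)) k   ≡⟨ cong (λ j → iterate s j k) (sym (reduce-suc p)) ⟩
    iterate s (reduce (suc p)) k ≡⟨ iterate-reduce k (suc p) ⟩
    reduce (k + suc p)           ≡⟨ cong reduce (+-suc k p) ⟩
    reduce (suc k + p)           ∎
    where open ≡-Reasoning

  iterate-toℕ : ∀ k j → iterate s j k ≡ reduce (k + toℕ j)
  iterate-toℕ k j = trans (cong (λ i → iterate s i k) (sym (reduce-toℕ j))) (iterate-reduce k (toℕ j))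

  iterate-≢ : ∀ {k} j → 0 < k → k < τ → iterate s j k ≢ j
  iterate-≢ {k} j 0<k k<τ eq =
    <⇒≢ 0<k (sym (reduce-window (toℕ j) k<τ (trans (sym (iterate-toℕ k j)) (trans eq (sym (reduce-toℕ j))))))

  predMod : Fin τ → Fin τ
  predMod j = iterate s j m

  s-predMod : ∀ j → s (predMod j) ≡ j
  s-predMod j = begin
    s (iterate s j m)     ≡⟨ cong s (iterate-toℕ m j) ⟩
    s (reduce (m + toℕ j))   ≡⟨ sym (reduce-suc (m + toℕ j)) ⟩
    reduce (τ + toℕ j)       ≡⟨ reduce-τ+ (toℕ j) ⟩
    reduce (toℕ j)           ≡⟨ reduce-toℕ j ⟩
    j                     ∎
    where open ≡-Reasoning

  predMod-s : ∀ j → predMod (s j) ≡ j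
  predMod-s j = trans (iterate-toℕ τ j) (trans (reduce-τ+ (toℕ j)) (reduce-toℕ j))

  s-injective : ∀ {i j} → s i ≡ s j → i ≡ j
  s-injective {i} {j} eq = trans (sym (predMod-s i)) (trans (cong predMod eq) (predMod-s j))

  offset : ∀ (j j' : Fin τ) → ∃[ d ] d < τ × reduce (d + toℕ j) ≡ j'
  offset j j' with toℕ j ≤? toℕ j'
  ... | yes t≤t' = toℕ j' ∸ toℕ j , ≤-<-trans (m∸n≤m (toℕ j') (toℕ j)) (toℕ<n j') ,
                   trans (cong reduce (m∸n+n≡m t≤t')) (reduce-toℕ j')
  ... | no t≰t'  = τ ∸ t + t' , d<τ , (begin
      reduce (τ ∸ t + t' + t)   ≡⟨ cong reduce (+-assoc (τ ∸ t) t' t) ⟩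
      reduce (τ ∸ t + (t' + t)) ≡⟨ cong (λ x → reduce (τ ∸ t + x)) (+-comm t' t) ⟩
      reduce (τ ∸ t + (t + t')) ≡⟨ cong reduce (sym (+-assoc (τ ∸ t) t t')) ⟩
      reduce (τ ∸ t + t + t')   ≡⟨ cong (λ x → reduce (x + t')) (m∸n+n≡m t≤τ) ⟩
      reduce (τ + t')           ≡⟨ reduce-τ+ t' ⟩
      reduce t'                 ≡⟨ reduce-toℕ j' ⟩
      j'                     ∎)
    where
    open ≡-Reasoning
    t = toℕ j
    t' = toℕ j'
    t≤τ : t ≤ τ
    t≤τ = <⇒≤ (toℕ<n j)
    d<τ : τ ∸ t + t' < τ
    d<τ = subst (τ ∸ t + t' <_) (m∸n+n≡m t≤τ) (+-monoʳ-< (τ ∸ t) (≰⇒> t≰t'))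

  Consecutive : Fin τ → Fin τ → Set
  Consecutive i j = j ≡ s i ⊎ i ≡ s j

  consecutive-≢ : 1 < τ → ∀ {i j} → Consecutive i j → i ≢ j
  consecutive-≢ 1<τ {i} (inj₁ j≡si) refl = iterate-≢ i (s≤s z≤n) 1<τ (sym j≡si)
  consecutive-≢ 1<τ {i} (inj₂ i≡sj) refl = iterate-≢ i (s≤s z≤n) 1<τ (sym i≡sj)

  -- two opposite steps at a shared vertex collapse an edge; three equal steps would need τ ∣ 3
  no-consecutive-triangle : 3 < τ → ∀ {a b c} → Consecutive a b → Consecutive b c → Consecutive c a → ⊥
  no-consecutive-triangle 3<τ = triangle
    where
    no-loop : ∀ {i j} → Consecutive i j → i ≢ j
    no-loop = consecutive-≢ (≤-trans (s≤s (s≤s z≤n)) (<⇒≤ 3<τ))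
    triangle : ∀ {a b c} → Consecutive a b → Consecutive b c → Consecutive c a → ⊥
    triangle {a} (inj₁ b≡sa) (inj₁ c≡sb) (inj₁ a≡sc) = iterate-≢ a (s≤s z≤n) 3<τ
      (trans (cong (λ x → s (s x)) (sym b≡sa)) (trans (cong s (sym c≡sb)) (sym a≡sc)))
    triangle {c = c} (inj₂ a≡sb) (inj₂ b≡sc) (inj₂ c≡sa) = iterate-≢ c (s≤s z≤n) 3<τ
      (trans (cong (λ x → s (s x)) (sym b≡sc)) (trans (cong s (sym a≡sb)) (sym c≡sa)))
    triangle e₁@(inj₁ b≡sa) (inj₁ c≡sb) (inj₂ c≡sa) = no-loop e₁ (sym (s-injective (trans (sym c≡sb) c≡sa)))
    triangle (inj₁ b≡sa) (inj₂ b≡sc) e₃             = no-loop e₃ (sym (s-injective (trans (sym b≡sa) b≡sc)))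
    triangle (inj₂ a≡sb) (inj₁ c≡sb) e₃             = no-loop e₃ (trans c≡sb (sym a≡sb))
    triangle (inj₂ a≡sb) e₂@(inj₂ b≡sc) (inj₁ a≡sc) = no-loop e₂ (s-injective (trans (sym a≡sb) a≡sc))

  climb : ∀ d p → Walk Consecutive d (reduce p) (reduce (d + p))
  climb zero    p = []
  climb (suc d) p =
    inj₁ (reduce-suc p) ∷ subst (Walk Consecutive d (reduce (suc p))) (cong reduce (+-suc d p)) (climb d (suc p))

  descend : ∀ d p → Walk Consecutive d (reduce (d + p)) (reduce p)
  descend zero    p = []
  descend (suc d) p = inj₂ (reduce-suc (d + p)) ∷ descend d p

  layerWalk : ∀ j j' → Walk Consecutive τ j j' ⊎ (Odd m × Walk Consecutive m j j')
  layerWalk j j' with offset j j'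
  ... | d , d<τ , arrive = choose (parity d) (parity m)
    where
    t = toℕ j
    up : ∀ {L} → d ≤₂ L → Walk Consecutive L j j'
    up = pad (inj₁ refl) (inj₂ refl) (subst₂ (Walk Consecutive d) (reduce-toℕ j) arrive (climb d t))
    around : reduce (τ ∸ d + (d + t)) ≡ j
    around = begin
      reduce (τ ∸ d + (d + t)) ≡⟨ cong reduce (sym (+-assoc (τ ∸ d) d t)) ⟩
      reduce (τ ∸ d + d + t)   ≡⟨ cong (λ x → reduce (x + t)) (m∸n+n≡m (<⇒≤ d<τ)) ⟩
      reduce (τ + t)           ≡⟨ reduce-τ+ t ⟩
      reduce t                 ≡⟨ reduce-toℕ j ⟩
      j                     ∎
      where open ≡-Reasoning
    down : ∀ {L} → τ ∸ d ≤₂ L → Walk Consecutive L j j'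
    down = pad (inj₁ refl) (inj₂ refl)
             (subst₂ (Walk Consecutive (τ ∸ d)) around arrive (descend (τ ∸ d) (d + t)))
    choose : Even d ⊎ Odd d → Even m ⊎ Odd m → Walk Consecutive τ j j' ⊎ (Odd m × Walk Consecutive m j j')
    choose (inj₂ odd-d)  (inj₂ odd-m)  = inj₂ (odd-m , up (≤⇒≤₂ odd-d odd-m (≤-pred d<τ)))
    choose (inj₂ odd-d)  (inj₁ even-m) = inj₁ (up (≤⇒≤₂ odd-d (≤₂-suc even-m) (<⇒≤ d<τ)))
    choose (inj₁ even-d) (inj₂ odd-m)  = inj₁ (up (≤⇒≤₂ even-d (odd⇒even-suc odd-m) (<⇒≤ d<τ)))
    choose (inj₁ even-d) (inj₁ even-m) = inj₁ (down (≤⇒≤₂ odd-rest odd-τ (m∸n≤m τ d)))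
      where
      odd-τ : Odd τ
      odd-τ = ≤₂-suc even-m
      odd-rest : Odd (τ ∸ d)
      odd-rest = odd-summand even-d (subst Odd (sym (m+[n∸m]≡n (<⇒≤ d<τ))) odd-τ)

Σ-T-≡ : ∀ {A : Set} {P : A → Bool} {x y : A} {p : T (P x)} {q : T (P y)} → x ≡ y →
        _≡_ {A = Σ A (λ z → T (P z))} (x , p) (y , q)
Σ-T-≡ refl = cong (_ ,_) (T-irrelevant _ _)

module Conduit (n : ℕ) (e : Fin n → Fin n → Bool) (σ : Fin n ↔ Fin n) where

  H : Graph
  H = bipartite n e

  private
    σ⁺ = Inverse.to σ
    σ⁻ = Inverse.from σ
    σ⁺σ⁻ : ∀ b → σ⁺ (σ⁻ b) ≡ b
    σ⁺σ⁻ = Inverse.strictlyInverseˡ σ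
    σ⁻σ⁺ : ∀ a → σ⁻ (σ⁺ a) ≡ a
    σ⁻σ⁺ = Inverse.strictlyInverseʳ σ

  R : Fin n → Fin n → Set
  R a b = T (e a (σ⁺ b))

  mutual
    walk-A→B-odd : ∀ {k a b} → Walk (Adj H) k (inj₁ a) (inj₂ b) → Odd k
    walk-A→B-odd (_∷_ {y = inj₁ _} () _)
    walk-A→B-odd (_∷_ {y = inj₂ _} _ w) = ≤₂-suc (walk-B→B-even w)

    walk-B→B-even : ∀ {k b b'} → Walk (Adj H) k (inj₂ b) (inj₂ b') → Even k
    walk-B→B-even []                      = 0 , refl
    walk-B→B-even (_∷_ {y = inj₁ _} _ w) = odd⇒even-suc (walk-A→B-odd w)
    walk-B→B-even (_∷_ {y = inj₂ _} () _)

  adjH-sym : ∀ u v → Adj H u v → Adj H v u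
  adjH-sym (inj₁ _) (inj₂ _) r = r
  adjH-sym (inj₂ _) (inj₁ _) r = r

  collapse : Fin n ⊎ Fin n → Fin n
  collapse (inj₁ a) = a
  collapse (inj₂ b) = σ⁻ b

  collapse-injective-on-neighbours : ∀ v u w → Adj H v u → Adj H v w → collapse u ≡ collapse w → u ≡ w
  collapse-injective-on-neighbours (inj₁ _) (inj₂ b) (inj₂ b') _ _ eq =
    cong inj₂ (trans (sym (σ⁺σ⁻ b)) (trans (cong σ⁺ eq) (σ⁺σ⁻ b')))
  collapse-injective-on-neighbours (inj₂ _) (inj₁ _) (inj₁ _) _ _ eq = cong inj₁ eq

  forward-nbhd : ∀ a → Σ (Fin n) (R a) ↔ Nbhd H (inj₁ a)
  forward-nbhd a = mk↔ₛ′ to from to∘from from∘to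
    where
    to : Σ (Fin n) (R a) → Nbhd H (inj₁ a)
    to (a' , r) = inj₂ (σ⁺ a') , r
    from : Nbhd H (inj₁ a) → Σ (Fin n) (R a)
    from (inj₂ b , r) = σ⁻ b , subst (λ b → T (e a b)) (sym (σ⁺σ⁻ b)) r
    to∘from : ∀ x → to (from x) ≡ x
    to∘from (inj₂ b , _) = Σ-T-≡ (cong inj₂ (σ⁺σ⁻ b))
    from∘to : ∀ x → from (to x) ≡ x
    from∘to (a' , _) = Σ-T-≡ (σ⁻σ⁺ a')

  backward-nbhd : ∀ a → Σ (Fin n) (λ a' → R a' a) ↔ Nbhd H (inj₂ (σ⁺ a))
  backward-nbhd a = mk↔ₛ′ to from to∘from (λ _ → refl)
    where
    to : Σ (Fin n) (λ a' → R a' a) → Nbhd H (inj₂ (σ⁺ a))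
    to (a' , r) = inj₁ a' , r
    from : Nbhd H (inj₂ (σ⁺ a)) → Σ (Fin n) (λ a' → R a' a)
    from (inj₁ a' , r) = a' , r
    to∘from : ∀ x → to (from x) ≡ x
    to∘from (inj₁ _ , _) = refl

  module SelfDual (sd : IsSelfDuality e σ) where

    R-sym : ∀ {a b} → R a b → R b a
    R-sym {a} {b} r = subst (λ x → T (e x (σ⁺ a))) (σ⁻σ⁺ b) (subst T (proj₂ sd (inj₁ a) (inj₂ (σ⁺ b))) r)

    collapse-adj : ∀ u v → Adj H u v → R (collapse u) (collapse v)
    collapse-adj (inj₁ a) (inj₂ b) r = subst (λ b → T (e a b)) (sym (σ⁺σ⁻ b)) r
    collapse-adj (inj₂ b) (inj₁ a) r = R-sym (collapse-adj (inj₁ a) (inj₂ b) r)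

    fork : ∀ {γ} → CycleOfLength H γ → ∃[ x ] ∃[ y ] ∃[ w ] R x y × R x w × y ≢ w
    fork C with CycleOfLength.len≥3 C
    ... | s≤s (s≤s (s≤s {n = g} _)) =
      collapse v₀ , collapse v₁ , collapse vₗ ,
      collapse-adj v₀ v₁ first , collapse-adj v₀ vₗ lastEdge ,
      λ eq → 1≢last (distinct (collapse-injective-on-neighbours v₀ v₁ vₗ first lastEdge eq))
      where
      open CycleOfLength C
      last = fromℕ (suc (suc g))
      v₀ = vert fzero
      v₁ = vert (fsuc fzero)
      vₗ = vert last
      first : Adj H v₀ v₁
      first = step fzero (fsuc fzero) refl
      lastEdge : Adj H v₀ vₗ
      lastEdge = adjH-sym vₗ v₀ (close last (cong suc (toℕ-fromℕ (suc (suc g)))) fzero refl)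
      1≢last : fsuc fzero ≢ last
      1≢last ()

  module Cyclic (m : ℕ) where

    open Layers m public

    G : Graph
    G = ψ τ n e σ

    adj-forward : ∀ {j a j' a'} → j' ≡ s j → R a a' → Adj G (j , a) (j' , a')
    adj-forward {j} {a} {j'} {a'} eq r = Equivalence.from (T-∨ {⌊ j' Fin.≟ s j ⌋ ∧ e a (σ⁺ a')})
      (inj₁ (Equivalence.from T-∧ (fromWitness eq , r)))

    adj-backward : ∀ {j a j' a'} → j ≡ s j' → R a' a → Adj G (j , a) (j' , a')
    adj-backward {j} {a} {j'} {a'} eq r = Equivalence.from (T-∨ {⌊ j' Fin.≟ s j ⌋ ∧ e a (σ⁺ a')})
      (inj₂ (Equivalence.from T-∧ (fromWitness eq , r)))

    adj-elim : ∀ j a j' a' → Adj G (j , a) (j' , a') → (j' ≡ s j × R a a') ⊎ (j ≡ s j' × R a' a)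
    adj-elim j a j' a' adj with Equivalence.to (T-∨ {⌊ j' Fin.≟ s j ⌋ ∧ e a (σ⁺ a')}) adj
    ... | inj₁ forward  = let (eq , r) = Equivalence.to T-∧ forward  in inj₁ (toWitness eq , r)
    ... | inj₂ backward = let (eq , r) = Equivalence.to T-∧ backward in inj₂ (toWitness eq , r)

    adj⇒consecutive : ∀ u v → Adj G u v → Consecutive (proj₁ u) (proj₁ v)
    adj⇒consecutive (j , a) (j' , a') adj = Sum.map proj₁ proj₁ (adj-elim j a j' a' adj)

    -- τ ≥ 3 keeps the successor and the predecessor layer of j apart
    nbhd-split : 2 < τ → ∀ j a → Nbhd G (j , a) ↔ (Σ (Fin n) (R a) ⊎ Σ (Fin n) (λ a' → R a' a))
    nbhd-split 2<τ j a = mk↔ₛ′ to from to∘from from∘to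
      where
      ss≢ : s (s j) ≢ j
      ss≢ = iterate-≢ j (s≤s z≤n) 2<τ
      to : Nbhd G (j , a) → Σ (Fin n) (R a) ⊎ Σ (Fin n) (λ a' → R a' a)
      to ((j' , a') , adj) = Sum.map (λ (_ , r) → a' , r) (λ (_ , r) → a' , r) (adj-elim j a j' a' adj)
      from : Σ (Fin n) (R a) ⊎ Σ (Fin n) (λ a' → R a' a) → Nbhd G (j , a)
      from (inj₁ (a' , r)) = (s j , a') , adj-forward refl r
      from (inj₂ (a' , r)) = (predMod j , a') , adj-backward (sym (s-predMod j)) r
      to∘from : ∀ x → to (from x) ≡ x
      to∘from (inj₁ (a' , r)) with adj-elim j a (s j) a' (adj-forward refl r)
      ... | inj₁ (_ , r')    = cong (λ r → inj₁ (a' , r)) (T-irrelevant r' r)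
      ... | inj₂ (j≡ssj , _) = ⊥-elim (ss≢ (sym j≡ssj))
      to∘from (inj₂ (a' , r)) with adj-elim j a (predMod j) a' (adj-backward (sym (s-predMod j)) r)
      ... | inj₁ (pj≡sj , _) = ⊥-elim (ss≢ (trans (cong s (sym pj≡sj)) (s-predMod j)))
      ... | inj₂ (_ , r')    = cong (λ r → inj₂ (a' , r)) (T-irrelevant r' r)
      from∘to : ∀ x → from (to x) ≡ x
      from∘to ((j' , a') , adj) with adj-elim j a j' a' adj
      ... | inj₁ (j'≡sj , _) = Σ-T-≡ (cong (_, a') (sym j'≡sj))
      ... | inj₂ (j≡sj' , _) = Σ-T-≡ (cong (_, a') (s-injective (trans (s-predMod j) j≡sj')))

    ψ-regular : 2 < τ → ∀ {Δ} → IsRegular H Δ → IsRegular G (2 * Δ)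
    ψ-regular 2<τ {Δ} reg (j , a) =
      ↔-trans (nbhd-split 2<τ j a) (↔-trans (forward-nbhd a ⊎-↔ backward-nbhd a)
        (↔-trans (reg (inj₁ a) ⊎-↔ reg (inj₂ (σ⁺ a))) (↔-trans Δ⊎Δ (↔-sym +↔⊎))))
      where
      Δ⊎Δ : (Fin Δ ⊎ Fin Δ) ↔ (Fin Δ ⊎ Fin (Δ + 0))
      Δ⊎Δ = subst (λ k → (Fin Δ ⊎ Fin Δ) ↔ (Fin Δ ⊎ Fin k)) (sym (+-identityʳ Δ)) ↔-refl

    vertex-≟ : DecidableEquality (Fin τ × Fin n)
    vertex-≟ = ≡-dec Fin._≟_ Fin._≟_

    ψ-no-triangle : 3 ≤ m → ¬ CycleOfLength G 3
    ψ-no-triangle 3≤m C = no-consecutive-triangle (s≤s 3≤m)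
      (adj⇒consecutive v₀ v₁ (step fzero (fsuc fzero) refl))
      (adj⇒consecutive v₁ v₂ (step (fsuc fzero) (fsuc (fsuc fzero)) refl))
      (adj⇒consecutive v₂ v₀ (close (fsuc (fsuc fzero)) refl fzero refl))
      where
      open CycleOfLength C
      v₀ = vert fzero
      v₁ = vert (fsuc fzero)
      v₂ = vert (fsuc (fsuc fzero))

    module _ (sd : IsSelfDuality e σ) where

      open SelfDual sd

      adj-intro : ∀ {j a j' a'} → Consecutive j j' → R a a' → Adj G (j , a) (j' , a')
      adj-intro (inj₁ eq) r = adj-forward eq r
      adj-intro (inj₂ eq) r = adj-backward eq (R-sym r)

      ψ-square : 3 ≤ m → ∀ {γ} → CycleOfLength H γ → CycleOfLength G 4
      ψ-square 3≤m C with fork C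
      ... | x , y , w , rxy , rxw , y≢w = cycleThrough G f (s≤s (s≤s z≤n)) f-inj step close
        where
        l₀ l₁ l₂ : Fin τ
        l₀ = fzero
        l₁ = s l₀
        l₂ = s l₁
        f : Fin 4 → Fin τ × Fin n
        f fzero                      = l₀ , x
        f (fsuc fzero)               = l₁ , y
        f (fsuc (fsuc fzero))        = l₂ , x
        f (fsuc (fsuc (fsuc fzero))) = l₁ , w
        step : ∀ i → Adj G (f (inject₁ i)) (f (fsuc i))
        step fzero               = adj-forward refl rxy
        step (fsuc fzero)        = adj-forward refl (R-sym rxy)
        step (fsuc (fsuc fzero)) = adj-backward refl (R-sym rxw)
        close : Adj G (f (fromℕ 3)) (f fzero)
        close = adj-backward refl rxw
        l₁≢l₀ : l₁ ≢ l₀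
        l₁≢l₀ = iterate-≢ l₀ (s≤s z≤n) (s≤s (≤-trans (s≤s z≤n) 3≤m))
        l₂≢l₁ : l₂ ≢ l₁
        l₂≢l₁ = iterate-≢ l₁ (s≤s z≤n) (s≤s (≤-trans (s≤s z≤n) 3≤m))
        l₂≢l₀ : l₂ ≢ l₀
        l₂≢l₀ = iterate-≢ l₀ (s≤s z≤n) (s≤s (≤-trans (s≤s (s≤s z≤n)) 3≤m))
        f-inj : ∀ {i j} → f i ≡ f j → i ≡ j
        f-inj {fzero} {fzero} _ = refl
        f-inj {fzero} {fsuc fzero} eq = ⊥-elim (l₁≢l₀ (sym (cong proj₁ eq)))
        f-inj {fzero} {fsuc (fsuc fzero)} eq = ⊥-elim (l₂≢l₀ (sym (cong proj₁ eq)))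
        f-inj {fzero} {fsuc (fsuc (fsuc fzero))} eq = ⊥-elim (l₁≢l₀ (sym (cong proj₁ eq)))
        f-inj {fsuc fzero} {fzero} eq = ⊥-elim (l₁≢l₀ (cong proj₁ eq))
        f-inj {fsuc fzero} {fsuc fzero} _ = refl
        f-inj {fsuc fzero} {fsuc (fsuc fzero)} eq = ⊥-elim (l₂≢l₁ (sym (cong proj₁ eq)))
        f-inj {fsuc fzero} {fsuc (fsuc (fsuc fzero))} eq = ⊥-elim (y≢w (cong proj₂ eq))
        f-inj {fsuc (fsuc fzero)} {fzero} eq = ⊥-elim (l₂≢l₀ (cong proj₁ eq))
        f-inj {fsuc (fsuc fzero)} {fsuc fzero} eq = ⊥-elim (l₂≢l₁ (cong proj₁ eq))
        f-inj {fsuc (fsuc fzero)} {fsuc (fsuc fzero)} _ = refl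
        f-inj {fsuc (fsuc fzero)} {fsuc (fsuc (fsuc fzero))} eq = ⊥-elim (l₂≢l₁ (cong proj₁ eq))
        f-inj {fsuc (fsuc (fsuc fzero))} {fzero} eq = ⊥-elim (l₁≢l₀ (cong proj₁ eq))
        f-inj {fsuc (fsuc (fsuc fzero))} {fsuc fzero} eq = ⊥-elim (y≢w (sym (cong proj₂ eq)))
        f-inj {fsuc (fsuc (fsuc fzero))} {fsuc (fsuc fzero)} eq = ⊥-elim (l₂≢l₁ (sym (cong proj₁ eq)))
        f-inj {fsuc (fsuc (fsuc fzero))} {fsuc (fsuc (fsuc fzero))} _ = refl

      module _ (conn : ∀ a b → PathAtMost H τ (inj₁ a) (inj₂ b)) where

        oddRWalk : ∀ a a' → ∃[ k ] Odd (suc k) × suc k ≤ τ × Walk R (suc k) a a'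
        oddRWalk a a' with conn a (σ⁺ a')
        ... | zero  , _   , P = ⊥-elim (even⇒¬odd (0 , refl) (walk-A→B-odd (pathOfLength⇒walk H P)))
        ... | suc k , l≤τ , P = k , walk-A→B-odd w , l≤τ , subst (Walk R (suc k) a) (σ⁻σ⁺ a') w′
          where
          w = pathOfLength⇒walk H P
          w′ = map collapse (λ {u} {v} → collapse-adj u v) w

        lengthen : ∀ {k L a a'} → Walk R (suc k) a a' → suc k ≤₂ L → Walk R L a a'
        lengthen w@(r ∷ _) = pad r (R-sym r) w

        rWalk-τ : ∀ a a' → Walk R τ a a'
        rWalk-τ a a' with parity τ
        ... | inj₂ odd-τ = let (_ , odd , l≤τ , w) = oddRWalk a a' in lengthen w (≤⇒≤₂ odd odd-τ l≤τ)
        ... | inj₁ even-τ with oddRWalk a a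
        ...   | _ , _ , _ , r ∷ _ = let (_ , odd , l≤τ , w) = oddRWalk _ a' in
                lengthen (r ∷ w) (≤⇒≤₂ (odd⇒even-suc odd) even-τ (odd<even odd even-τ l≤τ))

        rWalk-m : Odd m → ∀ a a' → Walk R m a a'
        rWalk-m odd-m a a' = let (_ , odd , l≤τ , w) = oddRWalk a a' in
          lengthen w (≤⇒≤₂ odd odd-m (≤-pred (odd<even odd (odd⇒even-suc odd-m) l≤τ)))

        ψ-connected : ∀ u v → PathAtMost G τ u v
        ψ-connected (j , a) (j' , a') with layerWalk j j'
        ... | inj₁ lw =
          walk⇒pathAtMost G vertex-≟ ≤-refl (zipWith _,_ adj-intro lw (rWalk-τ a a'))
        ... | inj₂ (odd-m , lw) =
          walk⇒pathAtMost G vertex-≟ (n≤1+n m) (zipWith _,_ adj-intro lw (rWalk-m odd-m a a'))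

        ψ-cycle-τ : 2 ≤ m → Fin n → CycleOfLength G τ
        ψ-cycle-τ 2≤m a = cycleThrough G f 2≤m (cong proj₁) step close
          where
          w = rWalk-τ a a
          f : Fin τ → Fin τ × Fin n
          f i = i , vertex w (inject₁ i)
          step : ∀ i → Adj G (f (inject₁ i)) (f (fsuc i))
          step i = adj-forward (sym (s-inject₁ i)) (vertex-step w (inject₁ i))
          close : Adj G (f (fromℕ m)) (f fzero)
          close = adj-forward (sym s-fromℕ) (subst (R _) (vertex-last w) (vertex-step w (fromℕ m)))

ℕ→ℚ-mkℚ : ∀ k → ℕ→ℚ k ≡ mkℚ (+ k) 0 (Coprime.sym (Coprime.1-coprimeTo k))
ℕ→ℚ-mkℚ k = normalize-coprime (Coprime.sym (Coprime.1-coprimeTo k))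

ℕ→ℚ-* : ∀ a b → ℕ→ℚ a ℚ.* ℕ→ℚ b ≡ ℕ→ℚ (a * b)
ℕ→ℚ-* a b = trans (cong₂ ℚ._*_ (ℕ→ℚ-mkℚ a) (ℕ→ℚ-mkℚ b)) (/-cong (sym (ℤ.pos-* a b)) refl)

ℕ→ℚ-nonNeg : ∀ k → NonNegative (ℕ→ℚ k)
ℕ→ℚ-nonNeg k rewrite ℕ→ℚ-mkℚ k = _

ℕ→ℚ-*-mono-≤ : ∀ t n {x} → x ℚ.≤ ℕ→ℚ n → ℕ→ℚ t ℚ.* x ℚ.≤ ℕ→ℚ (t * n)
ℕ→ℚ-*-mono-≤ t n x≤n =
  subst (_ ℚ.≤_) (ℕ→ℚ-* t n) (*-monoˡ-≤-nonNeg (ℕ→ℚ t) {{ℕ→ℚ-nonNeg t}} x≤n)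

ψ-girth : ∀ n (e : Fin n → Fin n → Bool) σ k → IsSelfDuality e σ →
          (∀ a b → PathAtMost (bipartite n e) (3 + k) (inj₁ a) (inj₂ b)) →
          ∀ {γ} → CycleOfLength (bipartite n e) γ → HasGirth (ψ (3 + k) n e σ) ((3 + k) ⊓ 4)
ψ-girth n e σ zero sd conn C =
  ψ-cycle-τ sd conn ≤-refl (proj₁ (fork C)) , λ l l<3 C' → <⇒≱ l<3 (CycleOfLength.len≥3 C')
  where
  open Conduit.Cyclic n e σ 2
  open Conduit.SelfDual n e σ sd
ψ-girth n e σ (suc k) sd conn C =
  subst (λ g → HasGirth G (4 + g)) (sym (⊓-zeroʳ k)) (ψ-square sd 3≤m C , shorter)
  where
  open Conduit.Cyclic n e σ (3 + k)
  3≤m : 3 ≤ 3 + k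
  3≤m = s≤s (s≤s (s≤s z≤n))
  shorter : ∀ l → l < 4 → ¬ CycleOfLength G l
  shorter l (s≤s l≤3) C' with m≤n⇒m<n∨m≡n l≤3
  ... | inj₁ l<3 = <⇒≱ l<3 (CycleOfLength.len≥3 C')
  ... | inj₂ refl = ψ-no-triangle 3≤m C'

proposition8 : (n τ Δ γ : ℕ) (c : ℚ) (e : Fin n → Fin n → Bool) (σ : Fin n ↔ Fin n)
    → 3 ≤ τ
    → GoodConduit n e τ Δ γ c
    → IsSelfDuality e σ
    → IsRegular (ψ τ n e σ) (2 * Δ)
      × HasGirth (ψ τ n e σ) (τ ⊓ 4)
      × ((Fin τ × Fin n) ↔ Fin (τ * n))
      × Data.Rational._≤_ (Data.Rational._*_ (ℕ→ℚ τ) (Data.Rational._*_ c (ℕ→ℚ (Δ Data.Nat.^ τ)))) (ℕ→ℚ (τ * n))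
      × (∀ u v → PathAtMost (ψ τ n e σ) τ u v)
proposition8 n (suc (suc (suc k))) Δ γ c e σ (s≤s (s≤s (s≤s z≤n))) gc sd =
  ψ-regular (s≤s (s≤s (s≤s z≤n))) regular ,
  ψ-girth n e σ k sd conn (proj₁ girth) ,
  ↔-sym *↔× ,
  ℕ→ℚ-*-mono-≤ τ n size ,
  ψ-connected sd conn
  where
  open GoodConduit gc
  open Conduit.Cyclic n e σ (suc (suc k))
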